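{- Let $\mathcal{P}$ and $\mathcal{P}_0$ be palettes. If every $\mathcal{P}$-colorable ordered hypergraph is also $\mathcal{P}_0$-colorable, then there exists a homomorphism from $\mathcal{P}$ to $\mathcal{P}_0$.
   Context: All hypergraphs are finite and $3$-uniform. A palette $\mathcal{P}=(C,T)$ consists of a finite nonempty set $C$ of colors and a set $T\subseteq C^3$ of feasible triples. An ordered hypergraph is a hypergraph together with a linear order $\preceq$ on its vertex set; it is $\mathcal{P}$-colorable if there is a coloring $c$ of the $2$-element subsets of its vertex set by colors from $C$ such that for every edge $\{u,v,w\}$ with $u\prec v\prec w$ we have $(c(uv),c(uw),c(vw))\in T$. A homomorphism from $(C,T)$ to $(C',T')$ is a map $f:C\to C'$ with $(f(x),f(y),f(z))\in T'$ for all $(x,y,z)\in T$. -}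

module Defs where

open import Data.Nat using (ℕ; suc)
open import Data.Fin using (Fin; _<_)
open import Data.Bool using (Bool; true)
open import Data.Product using (Σ)
open import Relation.Binary.PropositionalEquality using (_≡_)

record Palette : Set where
  field
    m         : ℕ
    feasible  : Fin (suc m) → Fin (suc m) → Fin (suc m) → Bool

open Palette public

Color : Palette → Set
Color P = Fin (suc (m P))

-- A finite ordered 3-uniform hypergraph: vertex set Fin n with its natural
-- linear order; the edge {u,v,w} with u < v < w is present iff edge u v w ≡ true
-- (values of edge on non-increasing triples are ignored).
record OrdHypergraph : Set where
  field
    n    : ℕ
    edge : Fin n → Fin n → Fin n → Bool

open OrdHypergraph public

-- A coloring of 2-element subsets {u,v} (u < v) is given by c u v;
-- values c u v with ¬ u < v are irrelevant.
IsPColoring : (P : Palette) (H : OrdHypergraph) →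
              (Fin (n H) → Fin (n H) → Color P) → Set
IsPColoring P H c =
  ∀ (u v w : Fin (n H)) → u < v → v < w → edge H u v w ≡ true →
  feasible P (c u v) (c u w) (c v w) ≡ true

Colorable : Palette → OrdHypergraph → Set
Colorable P H = Σ (Fin (n H) → Fin (n H) → Color P) (IsPColoring P H)

IsHom : (P P₀ : Palette) → (Color P → Color P₀) → Set
IsHom P P₀ f = ∀ (x y z : Color P) → feasible P x y z ≡ true →
  feasible P₀ (f x) (f y) (f z) ≡ true

-- Fix a colouring c of the pairs of an ordered hypergraph and take as edges
-- all triples that c colours feasibly: the hypergraph is P-colourable by
-- construction, so the hypothesis gives a P₀-colouring d. The hypergraph comes
-- from the partite construction of Nešetřil and Rödl, started from N parts each
-- holding one triangle per triple of colours; iterating the partite lemma (a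
-- consequence of Hales–Jewett) over all pairs of parts i < j and colours x
-- yields a copy of this picture on which d maps every pair of colour x between
-- parts i and j to one colour κ i j x. Ramsey's theorem finds parts
-- i₀ < i₁ < i₂ on which κ i j x = f x does not depend on i and j. For a feasible
-- triple (x, y, z), its triangle on these parts is an edge, so d makes
-- (f x, f y, f z) feasible for P₀.

module Submission where

open import Defs
open import Data.Bool using (true)
open import Data.Empty using (⊥-elim)
open import Data.Fin as Fin
  using (Fin; zero; suc; fromℕ; inject₁; funToFin; finToFun; _<_; _<?_; combine; remQuot)
open import Data.Fin.Properties
  using (_≟_; any?; pigeonhole; <⇒≢; <-irrefl; <-asym; finToFun-funToFin; remQuot-combine; combine-monoˡ-<)
open import Data.Fin.Relation.Unary.Top using (view; ‵fromℕ; ‵inject₁)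
open import Data.List using (List; []; _∷_; length; filter; tabulate; allFin; cartesianProduct)
import Data.List as List
open import Data.List.Properties using (length-tabulate; length-map)
open import Data.List.Membership.Propositional using (_∈_)
open import Data.List.Membership.Propositional.Properties
  using (∈-map⁺; ∈-++⁺ˡ; ∈-++⁺ʳ; ∈-cartesianProduct⁺; ∈-allFin; ∈-filter⁺; ∈-filter⁻; ∈-lookup)
open import Data.List.Relation.Unary.Any using (here; there; index)
open import Data.List.Relation.Unary.Any.Properties using (lookup-index)
open import Data.List.Relation.Unary.All as All using (All; []; _∷_)
import Data.List.Relation.Unary.All.Properties as Allₚ
open import Data.List.Relation.Unary.AllPairs using (AllPairs; []; _∷_)
import Data.List.Relation.Unary.AllPairs.Properties as AllPairsₚ
open import Data.List.Relation.Binary.Sublist.Propositional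
  using (_⊆_; []; _∷_; _∷ʳ_; ⊆-refl; ⊆-trans; minimum)
open import Data.List.Relation.Binary.Sublist.Propositional.Properties using (All-resp-⊆; map⁺; filter-⊆)
open import Data.Maybe using (Maybe; just; nothing; maybe; fromMaybe)
import Data.Maybe as Maybe
import Data.Maybe.Properties as Maybeₚ
open import Data.Nat using (ℕ; zero; suc; _+_; _*_; _^_; _≤_; _≤?_; z≤n; s≤s)
open import Data.Nat.Properties
  using (n<1+n; ≤-reflexive; +-suc; +-identityʳ; +-monoˡ-≤; +-cancelˡ-≤; ≰⇒>; <⇒≤; module ≤-Reasoning)
open import Data.Product using (Σ; _×_; _,_; proj₁; proj₂)
import Data.Product.Properties as Product
open import Data.Sum using (_⊎_; inj₁; inj₂; [_,_]′)
open import Data.Sum.Properties using (inj₁-injective)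
open import Data.Vec using (Vec; []; _∷_; map; _++_; replicate; lookup)
open import Data.Vec.Properties using (map-++; map-∘; map-cong; lookup-map)
open import Data.Vec.Relation.Unary.Any using (Any; here; there)
open import Data.Vec.Relation.Unary.Any.Properties using (++⁺ˡ; ++⁺ʳ)
open import Function using (id; _∘_)
open import Relation.Binary.Definitions using (DecidableEquality)
open import Relation.Binary.PropositionalEquality
  using (_≡_; _≢_; refl; sym; trans; cong; cong₂; subst; module ≡-Reasoning)
open import Relation.Nullary using (yes; no; ¬_)
open import Relation.Unary using (Decidable)
open import Relation.Unary.Properties using (∁?)

-- The Hales–Jewett theorem

Word : ℕ → ℕ → Set
Word k n = Vec (Fin k) n

-- A line is a word over the alphabet extended by a wildcard nothing; it is a
-- combinatorial line when the wildcard occurs.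
Line : ℕ → ℕ → Set
Line k n = Vec (Maybe (Fin k)) n

_⟨_⟩ : ∀ {k n} → Line k n → Fin k → Word k n
ℓ ⟨ a ⟩ = map (maybe (λ b → b) a) ℓ

HasWildcard : ∀ {k n} → Line k n → Set
HasWildcard = Any (_≡ nothing)

MonochromaticLine : ∀ {k n r} → (Word k n → Fin r) → Set
MonochromaticLine {k} {n} χ =
  Σ (Line k n) λ ℓ → HasWildcard ℓ × (∀ a b → χ (ℓ ⟨ a ⟩) ≡ χ (ℓ ⟨ b ⟩))

HalesJewett : ℕ → ℕ → ℕ → Set
HalesJewett k r n = (χ : Word k n → Fin r) → MonochromaticLine χ

constant : ∀ {k n} → Word k n → Line k n
constant = map just

constant⟨⟩ : ∀ {k n} (w : Word k n) a → constant w ⟨ a ⟩ ≡ w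
constant⟨⟩ []      a = refl
constant⟨⟩ (b ∷ w) a = cong (b ∷_) (constant⟨⟩ w a)

++⟨⟩ : ∀ {k m n} (ℓ₁ : Line k m) (ℓ₂ : Line k n) a → (ℓ₁ ++ ℓ₂) ⟨ a ⟩ ≡ ℓ₁ ⟨ a ⟩ ++ ℓ₂ ⟨ a ⟩
++⟨⟩ ℓ₁ ℓ₂ a = map-++ _ ℓ₁ ℓ₂

lift : ∀ {k n} → Line k n → Line (suc k) n
lift = map (Maybe.map inject₁)

lift⟨inject₁⟩ : ∀ {k n} (ℓ : Line k n) a → lift ℓ ⟨ inject₁ a ⟩ ≡ map inject₁ (ℓ ⟨ a ⟩)
lift⟨inject₁⟩ []             a = refl
lift⟨inject₁⟩ (just b  ∷ ℓ) a = cong (inject₁ b ∷_) (lift⟨inject₁⟩ ℓ a)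
lift⟨inject₁⟩ (nothing ∷ ℓ) a = cong (inject₁ a ∷_) (lift⟨inject₁⟩ ℓ a)

lift-wildcard : ∀ {k n} (ℓ : Line k n) → HasWildcard ℓ → HasWildcard (lift ℓ)
lift-wildcard (nothing ∷ ℓ) (here refl) = here refl
lift-wildcard (_ ∷ ℓ)       (there w)   = there (lift-wildcard ℓ w)

monochromatic-++ʳ : ∀ {k m n r} (χ : Word k (m + n) → Fin r) (w : Word k n) →
                    MonochromaticLine (λ u → χ (u ++ w)) → MonochromaticLine χ
monochromatic-++ʳ χ w (ℓ , wild , mono) = ℓ ++ constant w , ++⁺ˡ wild , λ a b →
  begin
    χ ((ℓ ++ constant w) ⟨ a ⟩) ≡⟨ cong χ (extend a) ⟩
    χ (ℓ ⟨ a ⟩ ++ w)            ≡⟨ mono a b ⟩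
    χ (ℓ ⟨ b ⟩ ++ w)            ≡⟨ cong χ (extend b) ⟨
    χ ((ℓ ++ constant w) ⟨ b ⟩) ∎
  where
  open ≡-Reasoning
  extend : ∀ a → (ℓ ++ constant w) ⟨ a ⟩ ≡ ℓ ⟨ a ⟩ ++ w
  extend a = trans (++⟨⟩ ℓ (constant w) a) (cong (ℓ ⟨ a ⟩ ++_) (constant⟨⟩ w a))

-- Colourings of words are coded by numbers, so that Hales–Jewett can be applied
-- with colourings of Word q n as colours.
#colourings : ℕ → ℕ → ℕ → ℕ
#colourings q r zero    = r
#colourings q r (suc n) = #colourings q r n ^ q

code : ∀ {q r} n → (Word q n → Fin r) → Fin (#colourings q r n)
code zero    g = g []
code (suc n) g = funToFin (λ a → code n (λ u → g (a ∷ u)))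

code-injective : ∀ {q r} n (g g′ : Word q n → Fin r) → code n g ≡ code n g′ → ∀ u → g u ≡ g′ u
code-injective zero    g g′ eq []      = eq
code-injective (suc n) g g′ eq (a ∷ u) = code-injective n (λ u → g (a ∷ u)) (λ u → g′ (a ∷ u)) coordinate u
  where
  coordinate : code n (λ u → g (a ∷ u)) ≡ code n (λ u → g′ (a ∷ u))
  coordinate = trans (sym (finToFun-funToFin _ a))
                 (trans (cong (λ i → finToFun i a) eq) (finToFun-funToFin _ a))

-- Over the alphabet Fin (suc k) the letter fromℕ k plays the role of the new
-- letter; s lines are focused when they meet at that letter, and each is
-- monochromatic on the old letters in pairwise distinct colours.
record Focused {k n r} (χ : Word (suc k) n → Fin r) (s : ℕ) : Set where
  field
    focus         : Word (suc k) n
    line          : Fin s → Line (suc k) n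
    colour        : Fin s → Fin r
    line-wildcard : ∀ i → HasWildcard (line i)
    line-focus    : ∀ i → line i ⟨ fromℕ k ⟩ ≡ focus
    line-colour   : ∀ i a → χ (line i ⟨ inject₁ a ⟩) ≡ colour i
    colour-injective : ∀ i j → colour i ≡ colour j → i ≡ j

nothing-focused : ∀ {k n r} (χ : Word (suc k) n → Fin r) → Focused χ 0
nothing-focused {n = n} χ = record
  { focus = replicate n zero ; line = λ () ; colour = λ ()
  ; line-wildcard = λ () ; line-focus = λ () ; line-colour = λ () ; colour-injective = λ () }

old-letters-agree : ∀ {k m n r} (χ : Word (suc k) (m + n) → Fin r) (ℓ : Line k n) →
  (∀ u a b → χ (u ++ map inject₁ (ℓ ⟨ a ⟩)) ≡ χ (u ++ map inject₁ (ℓ ⟨ b ⟩))) →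
  ∀ u a → χ (u ++ lift ℓ ⟨ inject₁ a ⟩) ≡ χ (u ++ lift ℓ ⟨ zero ⟩)
old-letters-agree {zero}  χ ℓ mono u ()
old-letters-agree {suc k} χ ℓ mono u a = begin
  χ (u ++ lift ℓ ⟨ inject₁ a ⟩)      ≡⟨ cong (λ w → χ (u ++ w)) (lift⟨inject₁⟩ ℓ a) ⟩
  χ (u ++ map inject₁ (ℓ ⟨ a ⟩))     ≡⟨ mono u a zero ⟩
  χ (u ++ map inject₁ (ℓ ⟨ zero ⟩))  ≡⟨ cong (λ w → χ (u ++ w)) (lift⟨inject₁⟩ ℓ zero) ⟨
  χ (u ++ lift ℓ ⟨ zero ⟩)           ∎
  where open ≡-Reasoning

-- One round of colour focusing: the first ns coordinates come from the
-- induction hypothesis, the last n′ from Hales–Jewett for the old letters,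
-- applied to the colouring that records the whole colouring of the heads.
module FocusingStep {k r s ns n′ : ℕ}
  (focusing : (χ : Word (suc k) ns → Fin r) → MonochromaticLine χ ⊎ Focused χ s)
  (hj : HalesJewett k (#colourings (suc k) r ns) n′)
  (χ : Word (suc k) (ns + n′) → Fin r) where

  open Focused

  tail-colouring : Word k n′ → Fin (#colourings (suc k) r ns)
  tail-colouring v = code ns (λ u → χ (u ++ map inject₁ v))

  tail : Line k n′
  tail = proj₁ (hj tail-colouring)

  tail-wildcard : HasWildcard tail
  tail-wildcard = proj₁ (proj₂ (hj tail-colouring))

  tail-monochromatic : ∀ u a b → χ (u ++ map inject₁ (tail ⟨ a ⟩)) ≡ χ (u ++ map inject₁ (tail ⟨ b ⟩))
  tail-monochromatic u a b = code-injective ns _ _ (proj₂ (proj₂ (hj tail-colouring)) a b) u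

  head-colouring : Word (suc k) ns → Fin r
  head-colouring u = χ (u ++ lift tail ⟨ zero ⟩)

  old-letters : ∀ u a → χ (u ++ lift tail ⟨ inject₁ a ⟩) ≡ head-colouring u
  old-letters = old-letters-agree χ tail tail-monochromatic

  module _ (F : Focused head-colouring s) where

    focus-coloured-line : ∀ i → head-colouring (focus F) ≡ colour F i →
                          ∀ a → head-colouring (line F i ⟨ a ⟩) ≡ colour F i
    focus-coloured-line i eq a with view a
    ... | ‵fromℕ      = trans (cong head-colouring (line-focus F i)) eq
    ... | ‵inject₁ a′ = line-colour F i a′

    extended-line : Fin (suc s) → Line (suc k) (ns + n′)
    extended-line zero    = constant (focus F) ++ lift tail
    extended-line (suc i) = line F i ++ lift tail

    extended-colour : Fin (suc s) → Fin r
    extended-colour zero    = head-colouring (focus F)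
    extended-colour (suc i) = colour F i

    extended-head : Fin (suc s) → Fin (suc k) → Word (suc k) ns
    extended-head zero    _ = focus F
    extended-head (suc i) a = line F i ⟨ a ⟩

    extended-line⟨⟩ : ∀ i a → extended-line i ⟨ a ⟩ ≡ extended-head i a ++ lift tail ⟨ a ⟩
    extended-line⟨⟩ zero    a = trans (++⟨⟩ (constant (focus F)) (lift tail) a)
                                      (cong (_++ _) (constant⟨⟩ (focus F) a))
    extended-line⟨⟩ (suc i) a = ++⟨⟩ (line F i) (lift tail) a

    extended-head-focus : ∀ i → extended-head i (fromℕ k) ≡ focus F
    extended-head-focus zero    = refl
    extended-head-focus (suc i) = line-focus F i

    extended-head-colour : ∀ i a → head-colouring (extended-head i (inject₁ a)) ≡ extended-colour i
    extended-head-colour zero    a = refl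
    extended-head-colour (suc i) a = line-colour F i a

    extended-wildcard : ∀ i → HasWildcard (extended-line i)
    extended-wildcard zero    = ++⁺ʳ (constant (focus F)) (lift-wildcard tail tail-wildcard)
    extended-wildcard (suc i) = ++⁺ˡ (line-wildcard F i)

    extended : (∀ i → head-colouring (focus F) ≢ colour F i) → Focused χ (suc s)
    extended new = record
      { focus = focus F ++ lift tail ⟨ fromℕ k ⟩
      ; line = extended-line
      ; colour = extended-colour
      ; line-wildcard = extended-wildcard
      ; line-focus = λ i → trans (extended-line⟨⟩ i _) (cong (_++ _) (extended-head-focus i))
      ; line-colour = λ i a → trans (cong χ (extended-line⟨⟩ i _))
                                (trans (old-letters _ a) (extended-head-colour i a))
      ; colour-injective = injective
      }
      where
      injective : ∀ i j → extended-colour i ≡ extended-colour j → i ≡ j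
      injective zero    zero    _  = refl
      injective zero    (suc j) eq = ⊥-elim (new j eq)
      injective (suc i) zero    eq = ⊥-elim (new i (sym eq))
      injective (suc i) (suc j) eq = cong suc (colour-injective F i j eq)

  step : MonochromaticLine χ ⊎ Focused χ (suc s)
  step with focusing head-colouring
  ... | inj₁ mono = inj₁ (monochromatic-++ʳ χ _ mono)
  ... | inj₂ F with any? (λ i → head-colouring (focus F) ≟ colour F i)
  ...   | yes (i , eq) = inj₁ (monochromatic-++ʳ χ _ (line F i , line-wildcard F i ,
                           λ a b → trans (focus-coloured-line F i eq a) (sym (focus-coloured-line F i eq b))))
  ...   | no  new      = inj₂ (extended F (λ i eq → new (i , eq)))

focusing : ∀ k r → (∀ r → Σ ℕ (HalesJewett k r)) → ∀ s →
           Σ ℕ λ n → (χ : Word (suc k) n → Fin r) → MonochromaticLine χ ⊎ Focused χ s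
focusing k r hj zero    = 0 , λ χ → inj₂ (nothing-focused χ)
focusing k r hj (suc s) =
  let (ns , focusing-ns) = focusing k r hj s
      (n′ , hj-n′)       = hj (#colourings (suc k) r ns)
  in  ns + n′ , FocusingStep.step focusing-ns hj-n′

too-many-colours : ∀ {k n r} {χ : Word (suc k) n → Fin r} → ¬ Focused χ (suc r)
too-many-colours {r = r} F =
  let (i , j , i<j , eq) = pigeonhole (n<1+n r) (Focused.colour F)
  in  <⇒≢ i<j (Focused.colour-injective F i j eq)

hales-jewett : ∀ k r → Σ ℕ (HalesJewett k r)
hales-jewett zero    r = 1 , λ χ → nothing ∷ [] , here refl , λ ()
hales-jewett (suc k) r =
  let (n , focusing-n) = focusing k r (hales-jewett k) (suc r)
  in  n , λ χ → [ id , ⊥-elim ∘ too-many-colours ]′ (focusing-n χ)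

hales-jewett⁺ : ∀ k q → Σ ℕ λ n → HalesJewett k (suc q) (suc n)
hales-jewett⁺ k q with hales-jewett k (suc q)
... | zero  , hj with () ← proj₁ (proj₂ (hj (λ _ → zero)))
... | suc n , hj = n , hj

-- Ramsey's theorem for pairs

module _ {A : Set} where

  AllPairs-resp-⊆ : ∀ {R : A → A → Set} {xs ys} → xs ⊆ ys → AllPairs R ys → AllPairs R xs
  AllPairs-resp-⊆ []         []       = []
  AllPairs-resp-⊆ (y ∷ʳ p)   (_ ∷ ps) = AllPairs-resp-⊆ p ps
  AllPairs-resp-⊆ (refl ∷ p) (a ∷ ps) = All-resp-⊆ p a ∷ AllPairs-resp-⊆ p ps

  length-filter+filter-∁ : ∀ {P : A → Set} (P? : Decidable P) xs →
                           length (filter P? xs) + length (filter (∁? P?) xs) ≡ length xs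
  length-filter+filter-∁ P? []       = refl
  length-filter+filter-∁ P? (x ∷ xs) with P? x
  ... | yes _ = cong suc (length-filter+filter-∁ P? xs)
  ... | no  _ = trans (+-suc _ _) (cong suc (length-filter+filter-∁ P? xs))

  module _ {B : Set} (_≟B_ : DecidableEquality B) (f : A → B) where

    pigeonhole-sublist : ∀ t c (cs : List B) (ys : List A) → All (λ y → f y ∈ c ∷ cs) ys →
      suc (length cs) * t ≤ length ys →
      Σ B λ d → Σ (List A) λ zs → zs ⊆ ys × All (λ z → f z ≡ d) zs × t ≤ length zs
    pigeonhole-sublist t c [] ys coloured large =
      c , ys , ⊆-refl , All.map (λ { (here eq) → eq }) coloured , subst (_≤ length ys) (+-identityʳ t) large
    pigeonhole-sublist t c (c′ ∷ cs) ys coloured large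
      with t ≤? length (filter (λ y → f y ≟B c) ys)
    ... | yes enough = c , _ , filter-⊆ _ ys , Allₚ.all-filter _ ys , enough
    ... | no  few    =
      let (d , zs , zs⊆ , mono , long) = pigeonhole-sublist t c′ cs others others-coloured others-large
      in  d , zs , ⊆-trans zs⊆ (filter-⊆ _ ys) , mono , long
      where
      others : List A
      others = filter (∁? (λ y → f y ≟B c)) ys
      others-coloured : All (λ y → f y ∈ c′ ∷ cs) others
      others-coloured = All.zipWith (λ { (here eq , ne) → ⊥-elim (ne eq) ; (there m , _) → m })
                          (Allₚ.filter⁺ _ coloured , Allₚ.all-filter _ ys)
      others-large : suc (length cs) * t ≤ length others
      others-large = +-cancelˡ-≤ t _ _ (begin
        t + suc (length cs) * t  ≤⟨ large ⟩
        length ys                 ≡⟨ length-filter+filter-∁ (λ y → f y ≟B c) ys ⟨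
        length (filter _ ys) + length others ≤⟨ +-monoˡ-≤ _ (<⇒≤ (≰⇒> few)) ⟩
        t + length others         ∎)
        where open ≤-Reasoning

  AllPairs-zipWith-All : ∀ {P : A → Set} {R S : A → A → Set} → (∀ {x y} → P x → R x y → S x y) →
                         ∀ {xs} → All P xs → AllPairs R xs → AllPairs S xs
  AllPairs-zipWith-All f []         []         = []
  AllPairs-zipWith-All f (px ∷ pxs) (rs ∷ rss) = All.map (f px) rs ∷ AllPairs-zipWith-All f pxs rss

  pigeonhole-Fin : ∀ {q} t (f : A → Fin (suc q)) (ys : List A) → suc q * t ≤ length ys →
    Σ (Fin (suc q)) λ d → Σ (List A) λ zs → zs ⊆ ys × All (λ z → f z ≡ d) zs × t ≤ length zs
  pigeonhole-Fin {q} t f ys large =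
    pigeonhole-sublist _≟_ f t zero (tabulate {n = q} Fin.suc) ys (All.universal (λ y → ∈-allFin (f y)) ys)
      (subst (λ n → suc n * t ≤ length ys) (sym (length-tabulate {n = q} Fin.suc)) large)

module _ {q : ℕ} where

  Monochromatic : ∀ {A : Set} → (A → A → Fin (suc q)) → Fin (suc q) → List A → Set
  Monochromatic κ c = AllPairs (λ u v → κ u v ≡ c)

  -- Each vertex carries the colour it receives towards all later vertices.
  EndHomogeneous : ∀ {A : Set} → (A → A → Fin (suc q)) → A × Fin (suc q) → A × Fin (suc q) → Set
  EndHomogeneous κ (x , c) (y , _) = κ x y ≡ c

  endHomogeneousBound : ℕ → ℕ
  endHomogeneousBound zero    = 0
  endHomogeneousBound (suc L) = suc (suc q * endHomogeneousBound L)

  end-homogeneous : ∀ {A : Set} (κ : A → A → Fin (suc q)) L (ys : List A) → endHomogeneousBound L ≤ length ys →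
    Σ (List (A × Fin (suc q))) λ xs → List.map proj₁ xs ⊆ ys × L ≤ length xs × AllPairs (EndHomogeneous κ) xs
  end-homogeneous κ zero    ys       _            = [] , minimum ys , z≤n , []
  end-homogeneous κ (suc L) (y ∷ ys) (s≤s large) =
    let (c , zs , zs⊆ys , towards-c , long) = pigeonhole-Fin (endHomogeneousBound L) (κ y) ys large
        (xs , xs⊆zs , length-xs , hom)       = end-homogeneous κ L zs long
    in  (y , c) ∷ xs , refl ∷ ⊆-trans xs⊆zs zs⊆ys , s≤s length-xs ,
        Allₚ.map⁻ (All-resp-⊆ xs⊆zs towards-c) ∷ hom

  ramsey : ∀ t → Σ ℕ λ N → ∀ {A : Set} (κ : A → A → Fin (suc q)) (ys : List A) → N ≤ length ys →
    Σ (List A) λ xs → xs ⊆ ys × t ≤ length xs × Σ (Fin (suc q)) λ c → Monochromatic κ c xs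
  ramsey t = endHomogeneousBound (suc q * t) , λ κ ys large →
    let (xs , xs⊆ys , length-xs , hom)      = end-homogeneous κ (suc q * t) ys large
        (c , zs , zs⊆xs , coloured , long) = pigeonhole-Fin t proj₂ xs length-xs
    in  List.map proj₁ zs , ⊆-trans (map⁺ proj₁ zs⊆xs) xs⊆ys ,
        subst (t ≤_) (sym (length-map proj₁ zs)) long , c ,
        AllPairsₚ.map⁺ (AllPairs-zipWith-All (λ { refl eq → eq }) coloured (AllPairs-resp-⊆ zs⊆xs hom))

  simultaneous-ramsey : ∀ n t → Σ ℕ λ N → ∀ {A : Set} (κ : Fin n → A → A → Fin (suc q)) (ys : List A) →
    N ≤ length ys → Σ (List A) λ xs → xs ⊆ ys × t ≤ length xs ×
                                     (∀ i → Σ (Fin (suc q)) λ c → Monochromatic (κ i) c xs)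
  simultaneous-ramsey zero    t = t , λ κ ys large → ys , ⊆-refl , large , λ ()
  simultaneous-ramsey (suc n) t =
    let (N′ , ramsey-rest) = simultaneous-ramsey n t
        (N , ramsey-first) = ramsey N′
    in  N , λ κ ys large →
      let (xs₁ , xs₁⊆ys , long₁ , c₀ , mono₀) = ramsey-first (κ zero) ys large
          (xs , xs⊆xs₁ , long , mono)         = ramsey-rest (κ ∘ suc) xs₁ long₁
      in  xs , ⊆-trans xs⊆xs₁ xs₁⊆ys , long ,
          λ { zero → c₀ , AllPairs-resp-⊆ xs⊆xs₁ mono₀ ; (suc i) → mono i }

first-three : ∀ {A : Set} (xs : List A) → 3 ≤ length xs → Σ A λ a → Σ A λ b → Σ A λ c →
              ∀ {R : A → A → Set} → AllPairs R xs → R a b × R a c × R b c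
first-three (a ∷ b ∷ c ∷ _) _ = a , b , c , λ { ((ab ∷ ac ∷ _) ∷ (bc ∷ _) ∷ _) → ab , ac , bc }
first-three []              ()
first-three (_ ∷ [])        (s≤s ())
first-three (_ ∷ _ ∷ [])    (s≤s (s≤s ()))

record UniformTriangle {N k q : ℕ} (κ : Fin N → Fin N → Fin k → Fin (suc q)) : Set where
  field
    value      : Fin k → Fin (suc q)
    i₀ i₁ i₂   : Fin N
    i₀<i₁      : i₀ < i₁
    i₀<i₂      : i₀ < i₂
    i₁<i₂      : i₁ < i₂
    uniform₀₁  : ∀ x → κ i₀ i₁ x ≡ value x
    uniform₀₂  : ∀ x → κ i₀ i₂ x ≡ value x
    uniform₁₂  : ∀ x → κ i₁ i₂ x ≡ value x

uniform-triangle : ∀ k q → Σ ℕ λ N → (κ : Fin N → Fin N → Fin k → Fin (suc q)) → UniformTriangle κ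
uniform-triangle k q =
  let (N , homogeneous) = simultaneous-ramsey {q = q} k 3
  in  N , λ κ →
    let (X , X⊆ , long , mono) = homogeneous (λ x u v → κ u v x) (allFin N) (≤-reflexive (sym (length-tabulate id)))
        (i₀ , i₁ , i₂ , three) = first-three X long
        (i₀<i₁ , i₀<i₂ , i₁<i₂) = three {_<_} (AllPairs-resp-⊆ X⊆ (AllPairsₚ.tabulate⁺-< id))
    in record
      { value = λ x → proj₁ (mono x)
      ; i₀ = i₀ ; i₁ = i₁ ; i₂ = i₂
      ; i₀<i₁ = i₀<i₁ ; i₀<i₂ = i₀<i₂ ; i₁<i₂ = i₁<i₂
      ; uniform₀₁ = λ x → proj₁ (three (proj₂ (mono x)))
      ; uniform₀₂ = λ x → proj₁ (proj₂ (three (proj₂ (mono x))))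
      ; uniform₁₂ = λ x → proj₂ (proj₂ (three (proj₂ (mono x))))
      }

-- Pictures and the partite construction

Enumeration : Set → Set
Enumeration V = Σ (List V) λ xs → ∀ v → v ∈ xs

enumerate-Fin : ∀ n → Enumeration (Fin n)
enumerate-Fin n = allFin n , ∈-allFin

enumerate-⊎ : ∀ {A B} → Enumeration A → Enumeration B → Enumeration (A ⊎ B)
enumerate-⊎ (xs , x∈) (ys , y∈) = List.map inj₁ xs List.++ List.map inj₂ ys , λ where
  (inj₁ x) → ∈-++⁺ˡ (∈-map⁺ inj₁ (x∈ x))
  (inj₂ y) → ∈-++⁺ʳ _ (∈-map⁺ inj₂ (y∈ y))

enumerate-× : ∀ {A B} → Enumeration A → Enumeration B → Enumeration (A × B)
enumerate-× (xs , x∈) (ys , y∈) = cartesianProduct xs ys , λ (x , y) → ∈-cartesianProduct⁺ (x∈ x) (y∈ y)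

enumerate-Maybe : ∀ {A} → Enumeration A → Enumeration (Maybe A)
enumerate-Maybe (xs , x∈) = nothing ∷ List.map just xs , λ where
  nothing  → here refl
  (just x) → there (∈-map⁺ just (x∈ x))

enumerate-Vec : ∀ {A} n → Enumeration A → Enumeration (Vec A n)
enumerate-Vec zero    _ = [] ∷ [] , λ { [] → here refl }
enumerate-Vec (suc n) e =
  let (xs , x∈) = e
      (vs , v∈) = enumerate-Vec n e
  in  List.map (λ (x , v) → x ∷ v) (cartesianProduct xs vs) ,
      λ { (x ∷ v) → ∈-map⁺ (λ (x , v) → x ∷ v) (∈-cartesianProduct⁺ (x∈ x) (v∈ v)) }

firstWildcard : ∀ {k n} → Line k (suc n) → Fin (suc n)
firstWildcard (nothing ∷ ℓ)          = zero
firstWildcard (just _ ∷ [])          = zero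
firstWildcard (just _ ∷ ℓ@(_ ∷ _))   = suc (firstWildcard ℓ)

lookup-firstWildcard : ∀ {k n} (ℓ : Line k (suc n)) → HasWildcard ℓ → lookup ℓ (firstWildcard ℓ) ≡ nothing
lookup-firstWildcard (nothing ∷ ℓ)        _         = refl
lookup-firstWildcard (just _ ∷ [])        (here ())
lookup-firstWildcard (just _ ∷ (_ ∷ _))   (here ())
lookup-firstWildcard (just _ ∷ ℓ@(_ ∷ _)) (there w) = lookup-firstWildcard ℓ w

constantValue : ∀ {A : Set} m → A → (Fin m → A) → A
constantValue zero    a g = a
constantValue (suc m) _ g = g zero

constantValue-correct : ∀ {A : Set} m (a : A) (g : Fin m → A) → (∀ i j → g i ≡ g j) →
                        ∀ i → g i ≡ constantValue m a g
constantValue-correct (suc m) a g constant i = constant i zero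

module Partite {C : Set} (_≟C_ : DecidableEquality C) (q : ℕ) where

  _≟?_ : DecidableEquality (Maybe C)
  _≟?_ = Maybeₚ.≡-dec _≟C_

  -- Copies of a bipartite picture on V × V inside a larger one on Point × Point;
  -- left⁻¹ and right⁻¹ are retractions of the embeddings, used to colour the
  -- pairs that the amalgam forms with the other parts.
  record Amalgam (V : Set) : Set₁ where
    field
      Point           : Set
      enumeratePoints : Enumeration Point
      colour          : Point → Point → Maybe C
      Copy            : Set
      enumerateCopies : Enumeration Copy
      left right      : Copy → V → Point
      left⁻¹ right⁻¹  : Copy → Point → V

  record RamseyCopy {V : Set} (colour₀ : V → V → Maybe C) (x : C) (R : Amalgam V)
                    (d : Amalgam.Point R → Amalgam.Point R → Fin (suc q)) : Set where
    open Amalgam R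
    field
      copy             : Copy
      left-retraction  : ∀ a → left⁻¹ copy (left copy a) ≡ a
      right-retraction : ∀ b → right⁻¹ copy (right copy b) ≡ b
      colour-preserved : ∀ a b y → colour₀ a b ≡ just y → colour (left copy a) (right copy b) ≡ just y
      value            : Fin (suc q)
      monochromatic    : ∀ a b → colour₀ a b ≡ just x → d (left copy a) (right copy b) ≡ value

  -- The x-coloured pairs form the alphabet; a point is a word of pairs
  -- projected to one side, and a combinatorial line with the pair (a, b) at
  -- its wildcards yields a copy.
  module PartiteLemma {V : Set} (enumV : Enumeration V) (colour₀ : V → V → Maybe C) (x : C) where

    isX? : Decidable (λ (p : V × V) → colour₀ (proj₁ p) (proj₂ p) ≡ just x)
    isX? (a , b) = colour₀ a b ≟? just x

    xPairs : List (V × V)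
    xPairs = filter isX? (cartesianProduct (proj₁ enumV) (proj₁ enumV))

    #x : ℕ
    #x = length xPairs

    xPair : Fin #x → V × V
    xPair = List.lookup xPairs

    xPair-colour : ∀ e → colour₀ (proj₁ (xPair e)) (proj₂ (xPair e)) ≡ just x
    xPair-colour e = proj₂ (∈-filter⁻ isX? {xs = cartesianProduct (proj₁ enumV) (proj₁ enumV)} (∈-lookup e))

    xPair-index : ∀ a b → colour₀ a b ≡ just x → Σ (Fin #x) λ e → xPair e ≡ (a , b)
    xPair-index a b ab = index ab∈ , sym (lookup-index ab∈)
      where
      ab∈ : (a , b) ∈ xPairs
      ab∈ = ∈-filter⁺ isX? (∈-cartesianProduct⁺ (proj₂ enumV a) (proj₂ enumV b)) ab

    dim : ℕ
    dim = suc (proj₁ (hales-jewett⁺ #x q))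

    hj : HalesJewett #x (suc q) dim
    hj = proj₂ (hales-jewett⁺ #x q)

    left right : ∀ {n} → Line #x n → V → Vec V n
    left  ℓ a = map (maybe (λ e → proj₁ (xPair e)) a) ℓ
    right ℓ b = map (maybe (λ e → proj₂ (xPair e)) b) ℓ

    colour : ∀ {n} → Vec V n → Vec V n → Maybe C
    colour []      []      = just x
    colour (a ∷ u) (b ∷ v) with colour₀ a b ≟? just x
    ... | yes _ = colour u v
    ... | no  _ = colour₀ a b

    colour-x : ∀ {n} (ℓ : Line #x n) a b → colour₀ a b ≡ just x → colour (left ℓ a) (right ℓ b) ≡ just x
    colour-x []            a b ab = refl
    colour-x (just e ∷ ℓ)  a b ab with colour₀ (proj₁ (xPair e)) (proj₂ (xPair e)) ≟? just x
    ... | yes _ = colour-x ℓ a b ab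
    ... | no ¬x = ⊥-elim (¬x (xPair-colour e))
    colour-x (nothing ∷ ℓ) a b ab with colour₀ a b ≟? just x
    ... | yes _ = colour-x ℓ a b ab
    ... | no ¬x = ⊥-elim (¬x ab)

    colour-other : ∀ {n} (ℓ : Line #x n) a b → colour₀ a b ≢ just x → HasWildcard ℓ →
                   colour (left ℓ a) (right ℓ b) ≡ colour₀ a b
    colour-other (just e ∷ ℓ)  a b ab (there w) with colour₀ (proj₁ (xPair e)) (proj₂ (xPair e)) ≟? just x
    ... | yes _ = colour-other ℓ a b ab w
    ... | no ¬x = ⊥-elim (¬x (xPair-colour e))
    colour-other (nothing ∷ ℓ) a b ab _ with colour₀ a b ≟? just x
    ... | yes ab-x = ⊥-elim (ab ab-x)
    ... | no _     = refl

    colour-preserved : ∀ {n} (ℓ : Line #x n) → HasWildcard ℓ →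
                       ∀ a b y → colour₀ a b ≡ just y → colour (left ℓ a) (right ℓ b) ≡ just y
    colour-preserved ℓ w a b y ab with colour₀ a b ≟? just x
    ... | yes ab-x = trans (colour-x ℓ a b ab-x) (trans (sym ab-x) ab)
    ... | no  ¬x   = trans (colour-other ℓ a b ¬x w) ab

    amalgam : Amalgam V
    amalgam = record
      { Point = Vec V dim ; enumeratePoints = enumerate-Vec dim enumV ; colour = colour
      ; Copy = Line #x dim ; enumerateCopies = enumerate-Vec dim (enumerate-Maybe (enumerate-Fin #x))
      ; left = left ; right = right
      ; left⁻¹ = λ ℓ u → lookup u (firstWildcard ℓ) ; right⁻¹ = λ ℓ u → lookup u (firstWildcard ℓ) }

    left-retraction : ∀ (ℓ : Line #x dim) → HasWildcard ℓ → ∀ a → lookup (left ℓ a) (firstWildcard ℓ) ≡ a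
    left-retraction ℓ w a = trans (lookup-map (firstWildcard ℓ) _ ℓ)
                                  (cong (maybe (λ e → proj₁ (xPair e)) a) (lookup-firstWildcard ℓ w))

    right-retraction : ∀ (ℓ : Line #x dim) → HasWildcard ℓ → ∀ b → lookup (right ℓ b) (firstWildcard ℓ) ≡ b
    right-retraction ℓ w b = trans (lookup-map (firstWildcard ℓ) _ ℓ)
                                   (cong (maybe (λ e → proj₂ (xPair e)) b) (lookup-firstWildcard ℓ w))

    left⟨⟩ : ∀ {n} (ℓ : Line #x n) e a → proj₁ (xPair e) ≡ a →
             map (λ e → proj₁ (xPair e)) (ℓ ⟨ e ⟩) ≡ left ℓ a
    left⟨⟩ ℓ e a eq = trans (sym (map-∘ _ _ ℓ)) (map-cong (λ { (just _) → refl ; nothing → eq }) ℓ)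

    right⟨⟩ : ∀ {n} (ℓ : Line #x n) e b → proj₂ (xPair e) ≡ b →
              map (λ e → proj₂ (xPair e)) (ℓ ⟨ e ⟩) ≡ right ℓ b
    right⟨⟩ ℓ e b eq = trans (sym (map-∘ _ _ ℓ)) (map-cong (λ { (just _) → refl ; nothing → eq }) ℓ)

    ramsey-copy : ∀ d → RamseyCopy colour₀ x amalgam d
    ramsey-copy d = record
      { copy = ℓ
      ; left-retraction = left-retraction ℓ wild
      ; right-retraction = right-retraction ℓ wild
      ; colour-preserved = colour-preserved ℓ wild
      ; value = constantValue #x zero (λ e → χ (ℓ ⟨ e ⟩))
      ; monochromatic = monochromatic
      }
      where
      χ : Word #x dim → Fin (suc q)
      χ ω = d (map (λ e → proj₁ (xPair e)) ω) (map (λ e → proj₂ (xPair e)) ω)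
      ℓ : Line #x dim
      ℓ = proj₁ (hj χ)
      wild : HasWildcard ℓ
      wild = proj₁ (proj₂ (hj χ))
      monochromatic : ∀ a b → colour₀ a b ≡ just x →
                      d (left ℓ a) (right ℓ b) ≡ constantValue #x zero (λ e → χ (ℓ ⟨ e ⟩))
      monochromatic a b ab =
        let (e , eq) = xPair-index a b ab
        in  trans (sym (cong₂ d (left⟨⟩ ℓ e a (cong proj₁ eq)) (right⟨⟩ ℓ e b (cong proj₂ eq))))
                  (constantValue-correct #x zero _ (proj₂ (proj₂ (hj χ))) e)

  partite-lemma : ∀ {V} → Enumeration V → (colour₀ : V → V → Maybe C) (x : C) →
                  Σ (Amalgam V) λ R → ∀ d → RamseyCopy colour₀ x R d
  partite-lemma enumV colour₀ x = PartiteLemma.amalgam enumV colour₀ x , PartiteLemma.ramsey-copy enumV colour₀ x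

  -- An N-partite picture: colour h a h′ b is the colour, if any, of the pair
  -- formed by a in part h and b in part h′; it is only read for h < h′.
  record Picture (N : ℕ) : Set₁ where
    field
      Vertex            : Set
      enumerateVertices : Enumeration Vertex
      colour            : Fin N → Vertex → Fin N → Vertex → Maybe C

  open Picture

  record Embedding {N} (P P′ : Picture N) : Set where
    field
      embed     : Fin N → Vertex P → Vertex P′
      preserves : ∀ {h h′} → h < h′ → ∀ a b {y} → colour P h a h′ b ≡ just y →
                  colour P′ h (embed h a) h′ (embed h′ b) ≡ just y

  open Embedding

  PairColouring : ∀ {N} → Picture N → Set
  PairColouring {N} P = Fin N → Vertex P → Fin N → Vertex P → Fin (suc q)

  _∘ᴱ_ : ∀ {N} {P P′ P″ : Picture N} → Embedding P′ P″ → Embedding P P′ → Embedding P P″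
  ι ∘ᴱ ι′ = record
    { embed = λ h a → embed ι h (embed ι′ h a)
    ; preserves = λ h<h′ a b ab → preserves ι h<h′ _ _ (preserves ι′ h<h′ a b ab) }

  Canonical : ∀ {N} {P P′ : Picture N} → PairColouring P′ → Embedding P P′ →
              Fin N → Fin N → C → Fin (suc q) → Set
  Canonical {P = P} d ι i j x c =
    ∀ a b → colour P i a j b ≡ just x → d i (embed ι i a) j (embed ι j b) ≡ c

  -- Parts i and j are replaced by the amalgam of the partite lemma, and every
  -- other part by one copy of itself per copy of the amalgam.
  module Amalgamation {N} (P : Picture N) {i j : Fin N} (i<j : i < j) (x : C) where

    R : Amalgam (Vertex P)
    R = proj₁ (partite-lemma (enumerateVertices P) (λ a b → colour P i a j b) x)

    open Amalgam R using (Point; Copy; left; right; left⁻¹; right⁻¹)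

    Vertex′ : Set
    Vertex′ = Point ⊎ (Copy × Vertex P)

    embed′ : Copy → Fin N → Vertex P → Vertex′
    embed′ γ h a with h ≟ i | h ≟ j
    ... | yes _ | _     = inj₁ (left γ a)
    ... | no _  | yes _ = inj₁ (right γ a)
    ... | no _  | no _  = inj₂ (γ , a)

    project : Fin N → Copy → Point → Vertex P
    project h γ w with h ≟ i
    ... | yes _ = left⁻¹ γ w
    ... | no _  = right⁻¹ γ w

    -- A point meets the other parts as the vertex of P it retracts to; this also
    -- colours pairs of points outside the copies, which is harmless.
    colour′ : Fin N → Vertex′ → Fin N → Vertex′ → Maybe C
    colour′ h (inj₁ w)       h′ (inj₁ w′) with h ≟ i | h′ ≟ j
    ... | yes _ | yes _ = Amalgam.colour R w w′
    ... | _     | _     = nothing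
    colour′ h (inj₁ w)       h′ (inj₂ (γ , b)) = colour P h (project h γ w) h′ b
    colour′ h (inj₂ (γ , a)) h′ (inj₁ w′)      = colour P h a h′ (project h′ γ w′)
    colour′ h (inj₂ (_ , a)) h′ (inj₂ (_ , b)) = colour P h a h′ b

    P′ : Picture N
    P′ = record
      { Vertex = Vertex′
      ; enumerateVertices = enumerate-⊎ (Amalgam.enumeratePoints R)
                              (enumerate-× (Amalgam.enumerateCopies R) (enumerateVertices P))
      ; colour = colour′ }

    embed-i : ∀ γ a → embed′ γ i a ≡ inj₁ (left γ a)
    embed-i γ a with i ≟ i
    ... | yes _ = refl
    ... | no i≢i = ⊥-elim (i≢i refl)

    embed-j : ∀ γ b → embed′ γ j b ≡ inj₁ (right γ b)
    embed-j γ b with j ≟ i | j ≟ j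
    ... | yes refl | _     = ⊥-elim (<-irrefl refl i<j)
    ... | no _     | yes _ = refl
    ... | no _     | no j≢j = ⊥-elim (j≢j refl)

    colour′-ij : ∀ w w′ → colour′ i (inj₁ w) j (inj₁ w′) ≡ Amalgam.colour R w w′
    colour′-ij w w′ with i ≟ i | j ≟ j
    ... | yes _ | yes _  = refl
    ... | no i≢i | _     = ⊥-elim (i≢i refl)
    ... | yes _ | no j≢j = ⊥-elim (j≢j refl)

    embed-part : ∀ γ h a {w} → embed′ γ h a ≡ inj₁ w → h ≡ i ⊎ h ≡ j
    embed-part γ h a eq with h ≟ i | h ≟ j
    ... | yes h≡i | _     = inj₁ h≡i
    ... | no _    | yes h≡j = inj₂ h≡j
    ... | no _    | no _  with () ← eq

    embed-inj₂ : ∀ γ h a {γ′ a′} → embed′ γ h a ≡ inj₂ (γ′ , a′) → γ′ ≡ γ × a′ ≡ a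
    embed-inj₂ γ h a eq with h ≟ i | h ≟ j
    ... | yes _ | _     with () ← eq
    ... | no _  | yes _ with () ← eq
    ... | no _  | no _  with refl ← eq = refl , refl

    module _ {d} (D : RamseyCopy (λ a b → colour P i a j b) x R d) where

      open RamseyCopy D

      project-embed : ∀ h a {w} → embed′ copy h a ≡ inj₁ w → project h copy w ≡ a
      project-embed h a eq with h ≟ i | h ≟ j
      ... | yes _ | _     with refl ← eq = left-retraction a
      ... | no _  | yes _ with refl ← eq = right-retraction a
      ... | no _  | no _  with () ← eq

      embedding : Embedding P P′
      embedding .embed = embed′ copy
      embedding .preserves {h} {h′} h<h′ a b ab with embed′ copy h a in ea | embed′ copy h′ b in eb
      ... | inj₂ _ | inj₂ _
        with refl , refl ← embed-inj₂ copy h a ea | refl , refl ← embed-inj₂ copy h′ b eb = ab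
      ... | inj₁ _ | inj₂ _
        with refl , refl ← embed-inj₂ copy h′ b eb rewrite project-embed h a ea = ab
      ... | inj₂ _ | inj₁ _
        with refl , refl ← embed-inj₂ copy h a ea rewrite project-embed h′ b eb = ab
      ... | inj₁ w | inj₁ w′ with embed-part copy h a ea | embed-part copy h′ b eb
      ...   | inj₁ refl | inj₁ refl = ⊥-elim (<-irrefl refl h<h′)
      ...   | inj₂ refl | inj₂ refl = ⊥-elim (<-irrefl refl h<h′)
      ...   | inj₂ refl | inj₁ refl = ⊥-elim (<-asym h<h′ i<j)
      ...   | inj₁ refl | inj₂ refl
        with refl ← inj₁-injective (trans (sym (embed-i copy a)) ea)
           | refl ← inj₁-injective (trans (sym (embed-j copy b)) eb) =
        trans (colour′-ij _ _) (colour-preserved a b _ ab)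

    amalgamate : ∀ (d : PairColouring P′) → Σ (Embedding P P′) λ ι → Σ (Fin (suc q)) (Canonical d ι i j x)
    amalgamate d = embedding D , value D , λ a b ab →
      trans (cong₂ (λ u v → d i u j v) (embed-i (copy D) a) (embed-j (copy D) b)) (monochromatic D a b ab)
      where
      open RamseyCopy
      D = proj₂ (partite-lemma (enumerateVertices P) (λ a b → colour P i a j b) x)
                (λ w w′ → d i (inj₁ w) j (inj₁ w′))

  idᴱ : ∀ {N} {P : Picture N} → Embedding P P
  idᴱ = record { embed = λ _ a → a ; preserves = λ _ _ _ ab → ab }

  pullback : ∀ {N} {P P′ : Picture N} → PairColouring P′ → Embedding P P′ → PairColouring P
  pullback d ι h a h′ b = d h (embed ι h a) h′ (embed ι h′ b)

  Canonizes : ∀ {N} → List (Fin N × Fin N × C) → Picture N → Picture N → Set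
  Canonizes {N} L P P′ = ∀ (d : PairColouring P′) → Σ (Embedding P P′) λ ι →
    Σ (Fin N → Fin N → C → Fin (suc q)) λ κ →
    ∀ {i j x} → (i , j , x) ∈ L → i < j → Canonical d ι i j x (κ i j x)

  canonizes-[] : ∀ {N} (P : Picture N) → Canonizes [] P P
  canonizes-[] P d = idᴱ , (λ _ _ _ → zero) , λ ()

  canonizes-skip : ∀ {N} {L} {P P′ : Picture N} {i j} x → ¬ i < j →
                   Canonizes L P P′ → Canonizes ((i , j , x) ∷ L) P P′
  canonizes-skip x i≮j canon d =
    let (ι , κ , canonical) = canon d
    in  ι , κ , λ where
          (here refl) i<j → ⊥-elim (i≮j i<j)
          (there t∈L)     → canonical t∈L

  canonizes-∷ : ∀ {N} {L} {P P″ : Picture N} {i j} (i<j : i < j) x →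
                Canonizes L P P″ → Canonizes ((i , j , x) ∷ L) P (Amalgamation.P′ P″ i<j x)
  canonizes-∷ {N} {L} {P} {P″} {i} {j} i<j x canon d with Amalgamation.amalgamate P″ i<j x d
  ... | ι₁ , c , canonical₁ with canon (pullback d ι₁)
  ... | ι₂ , κ , canonical₂ = ι₁ ∘ᴱ ι₂ , κ′ , canonical
    where
    _≟T_ : DecidableEquality (Fin N × Fin N × C)
    _≟T_ = Product.≡-dec _≟_ (Product.≡-dec _≟_ _≟C_)

    κ′ : Fin N → Fin N → C → Fin (suc q)
    κ′ i′ j′ x′ with (i′ , j′ , x′) ≟T (i , j , x)
    ... | yes _ = c
    ... | no _  = κ i′ j′ x′

    canonical : ∀ {i′ j′ x′} → (i′ , j′ , x′) ∈ (i , j , x) ∷ L → i′ < j′ →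
                Canonical d (ι₁ ∘ᴱ ι₂) i′ j′ x′ (κ′ i′ j′ x′)
    canonical {i′} {j′} {x′} t∈ i′<j′ a b ab with (i′ , j′ , x′) ≟T (i , j , x) | t∈
    ... | yes refl | _         = canonical₁ _ _ (preserves ι₂ i<j a b ab)
    ... | no t≢    | here t≡   = ⊥-elim (t≢ t≡)
    ... | no _     | there t∈L = canonical₂ t∈L i′<j′ a b ab

  partite-construction : ∀ {N} (L : List (Fin N × Fin N × C)) (P : Picture N) →
                         Σ (Picture N) (Canonizes L P)
  partite-construction []              P = P , canonizes-[] P
  partite-construction ((i , j , x) ∷ L) P with partite-construction L P | i <? j
  ... | P″ , canon | yes i<j = Amalgamation.P′ P″ i<j x , canonizes-∷ i<j x canon
  ... | P″ , canon | no i≮j  = P″ , canonizes-skip x i≮j canon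

-- Palette homomorphisms

feasible-cong : ∀ (P : Palette) {x x′ y y′ z z′} → x ≡ x′ → y ≡ y′ → z ≡ z′ →
                feasible P x y z ≡ feasible P x′ y′ z′
feasible-cong P refl refl refl = refl

module Reduction (P P₀ : Palette) where

  open Partite {Color P} _≟_ (m P₀)
  open Picture
  open Embedding

  allTriples : ∀ N → List (Fin N × Fin N × Color P)
  allTriples N = cartesianProduct (allFin N) (cartesianProduct (allFin N) (allFin _))

  ∈-allTriples : ∀ {N} i j x → (i , j , x) ∈ allTriples N
  ∈-allTriples i j x = ∈-cartesianProduct⁺ (∈-allFin i) (∈-cartesianProduct⁺ (∈-allFin j) (∈-allFin x))

  TriangleVertex : Set
  TriangleVertex = (Color P × Color P × Color P) × Fin 3

  -- Vertex (τ , k) is corner k of a triangle coloured by τ. The colour of a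
  -- pair is read off its first vertex alone; only pairs of corners of a common
  -- triangle are used later, and the additional colours do no harm.
  triangles : ∀ N → Picture N
  triangles N = record
    { Vertex = TriangleVertex
    ; enumerateVertices = enumerate-× (enumerate-× (enumerate-Fin _) (enumerate-× (enumerate-Fin _) (enumerate-Fin _)))
                                      (enumerate-Fin 3)
    ; colour = corner-colour }
    where
    corner-colour : Fin N → TriangleVertex → Fin N → TriangleVertex → Maybe (Color P)
    corner-colour _ ((x , _ , _) , zero)     _ (_ , suc zero)       = just x
    corner-colour _ ((_ , y , _) , zero)     _ (_ , suc (suc zero)) = just y
    corner-colour _ ((_ , _ , z) , suc zero) _ (_ , suc (suc zero)) = just z
    corner-colour _ _                        _ _                    = nothing

  -- The vertices of part h are numbered combine h σ, so parts follow each
  -- other in the order of the hypergraph.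
  module PictureHypergraph {N} (Q : Picture N) where

    vertices : List (Vertex Q)
    vertices = proj₁ (enumerateVertices Q)

    S : ℕ
    S = length vertices

    vertex : Fin N → Vertex Q → Fin (N * S)
    vertex h a = combine h (index (proj₂ (enumerateVertices Q) a))

    colourAt : Fin N × Fin S → Fin N × Fin S → Color P
    colourAt (h , σ) (h′ , σ′) =
      fromMaybe zero (colour Q h (List.lookup vertices σ) h′ (List.lookup vertices σ′))

    pairColour : Fin (N * S) → Fin (N * S) → Color P
    pairColour u v = colourAt (remQuot S u) (remQuot S v)

    pairColour-vertex : ∀ h a h′ b → pairColour (vertex h a) (vertex h′ b) ≡ fromMaybe zero (colour Q h a h′ b)
    pairColour-vertex h a h′ b = trans (cong₂ colourAt (remQuot-combine h _) (remQuot-combine h′ _))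
      (cong₂ (λ a′ b′ → fromMaybe zero (colour Q h a′ h′ b′))
             (sym (lookup-index (proj₂ (enumerateVertices Q) a)))
             (sym (lookup-index (proj₂ (enumerateVertices Q) b))))

    hypergraph : OrdHypergraph
    hypergraph = record { n = N * S ; edge = λ u v w → feasible P (pairColour u v) (pairColour u w) (pairColour v w) }

    colourable : Colorable P hypergraph
    colourable = pairColour , λ _ _ _ _ _ feasible → feasible

    induced : (Fin (N * S) → Fin (N * S) → Color P₀) → PairColouring Q
    induced d h a h′ b = d (vertex h a) (vertex h′ b)

    homomorphism : (d : Fin (N * S) → Fin (N * S) → Color P₀) → IsPColoring P₀ hypergraph d →
      (ι : Embedding (triangles N) Q) (κ : Fin N → Fin N → Color P → Color P₀) →
      (∀ {i j x} → (i , j , x) ∈ allTriples N → i < j → Canonical (induced d) ι i j x (κ i j x)) →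
      (T : UniformTriangle κ) → IsHom P P₀ (UniformTriangle.value T)
    homomorphism d d-colouring ι κ canonical T x y z xyz = begin
      feasible P₀ (value x) (value y) (value z) ≡⟨ feasible-cong P₀ d₀₁ d₀₂ d₁₂ ⟨
      feasible P₀ (d u₀ u₁) (d u₀ u₂) (d u₁ u₂) ≡⟨ d-colouring u₀ u₁ u₂ u₀<u₁ u₁<u₂ u₀u₁u₂-edge ⟩
      true                                      ∎
      where
      open ≡-Reasoning
      open UniformTriangle T
      corner : Fin N → Fin 3 → Fin (N * S)
      corner i k = vertex i (embed ι i ((x , y , z) , k))
      u₀ u₁ u₂ : Fin (N * S)
      u₀ = corner i₀ zero
      u₁ = corner i₁ (suc zero)
      u₂ = corner i₂ (suc (suc zero))
      u₀<u₁ : u₀ < u₁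
      u₀<u₁ = combine-monoˡ-< _ _ i₀<i₁
      u₁<u₂ : u₁ < u₂
      u₁<u₂ = combine-monoˡ-< _ _ i₁<i₂
      colour-of : ∀ {i j} → i < j → ∀ k l {c} →
                  colour (triangles N) i ((x , y , z) , k) j ((x , y , z) , l) ≡ just c →
                  pairColour (corner i k) (corner j l) ≡ c
      colour-of i<j k l kl = trans (pairColour-vertex _ _ _ _) (cong (fromMaybe zero) (preserves ι i<j _ _ kl))
      u₀u₁u₂-edge : feasible P (pairColour u₀ u₁) (pairColour u₀ u₂) (pairColour u₁ u₂) ≡ true
      u₀u₁u₂-edge = trans (feasible-cong P (colour-of i₀<i₁ _ _ refl) (colour-of i₀<i₂ _ _ refl)
                                           (colour-of i₁<i₂ _ _ refl)) xyz
      d₀₁ : d u₀ u₁ ≡ value x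
      d₀₁ = trans (canonical (∈-allTriples _ _ _) i₀<i₁ _ _ refl) (uniform₀₁ x)
      d₀₂ : d u₀ u₂ ≡ value y
      d₀₂ = trans (canonical (∈-allTriples _ _ _) i₀<i₂ _ _ refl) (uniform₀₂ y)
      d₁₂ : d u₁ u₂ ≡ value z
      d₁₂ = trans (canonical (∈-allTriples _ _ _) i₁<i₂ _ _ refl) (uniform₁₂ z)

  open PictureHypergraph public

  canonizing-picture : ∀ N → Σ (Picture N) (Canonizes (allTriples N) (triangles N))
  canonizing-picture N = partite-construction (allTriples N) (triangles N)

open Reduction

lemma4p1 : (P P₀ : Palette) →
    ((H : OrdHypergraph) → Colorable P H → Colorable P₀ H) →
    Σ (Color P → Color P₀) (IsHom P P₀)
lemma4p1 P P₀ hyp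
  with N , uniform       ← uniform-triangle (suc (m P)) (m P₀)
  with Q , canonizes     ← canonizing-picture P P₀ N
  with d , d-colouring   ← hyp (hypergraph P P₀ Q) (colourable P P₀ Q)
  with ι , κ , canonical ← canonizes (induced P P₀ Q d)
  = UniformTriangle.value (uniform κ) , homomorphism P P₀ Q d d-colouring ι κ canonical (uniform κ)
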